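{- For any tree $T$, $\Gamma(T)\le z(T)^2$.
   Context: A proper coloring with colors $1,\dots,k$ is a Grundy coloring if for any $i<j$, every vertex of color $j$ has a neighbor of color $i$; $\Gamma(T)$ is the maximum number of colors in a Grundy coloring of $T$. A vertex of color $i$ is color-dominating if it has a neighbor of every other color $j\neq i$ used. A $z$-coloring is a proper coloring using $k$ colors which is a Grundy coloring, in which every color class contains a color-dominating vertex, and which contains color-dominating vertices $u_1,\dots,u_k$ with $u_j$ of color $j$ and $u_k$ adjacent to $u_j$ for every $j\neq k$. $z(T)$ is the maximum number of colors in a $z$-coloring of $T$. -}

module Defs where

open import Data.Nat using (ℕ; zero; suc; _+_; _≤_; _<_)
open import Data.Fin using (Fin)
open import Data.Bool using (Bool; T)
open import Data.List using (List; []; _∷_; length)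
open import Data.List.Relation.Unary.Unique.Propositional using (Unique)
open import Data.Product using (Σ; _×_; ∃; ∃-syntax)
open import Relation.Binary.PropositionalEquality using (_≡_; _≢_)
open import Relation.Nullary using (¬_)
open import Data.Unit using (⊤)

record Graph (n : ℕ) : Set where
  field
    adj   : Fin n → Fin n → Bool
    sym   : ∀ u v → T (adj u v) → T (adj v u)
    irrefl : ∀ v → ¬ T (adj v v)

module _ {n : ℕ} (G : Graph n) where
  open Graph G

  Adj : Fin n → Fin n → Set
  Adj u v = T (adj u v)

  Chain : List (Fin n) → Set
  Chain []            = ⊤
  Chain (x ∷ [])      = ⊤
  Chain (x ∷ y ∷ xs)  = Adj x y × Chain (y ∷ xs)

  data Walk : Fin n → Fin n → Set where
    here  : ∀ v → Walk v v
    step  : ∀ u w v → Adj u w → Walk w v → Walk u v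

  Connected : Set
  Connected = ∀ u v → Walk u v

  data Last : List (Fin n) → Fin n → Set where
    last-one  : ∀ x → Last (x ∷ []) x
    last-cons : ∀ x xs y → Last xs y → Last (x ∷ xs) y

  HasCycle : Set
  HasCycle = Σ (Fin n) λ x → Σ (List (Fin n)) λ xs → Σ (Fin n) λ y →
    (2 ≤ length xs) × Unique (x ∷ xs) × Chain (x ∷ xs) × Last xs y × Adj y x

  IsTree : Set
  IsTree = (1 ≤ n) × Connected × ¬ HasCycle

  ProperColoring : ℕ → (Fin n → ℕ) → Set
  ProperColoring k c =
      (∀ v → 1 ≤ c v × c v ≤ k)
    × (∀ u v → Adj u v → c u ≢ c v)
    × (∀ i → 1 ≤ i → i ≤ k → ∃[ v ] c v ≡ i)

  GrundyCondition : (Fin n → ℕ) → Set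
  GrundyCondition c = ∀ v i → 1 ≤ i → i < c v → ∃[ u ] (Adj v u × c u ≡ i)

  GrundyColoring : ℕ → (Fin n → ℕ) → Set
  GrundyColoring k c = ProperColoring k c × GrundyCondition c

  ColorDominating : ℕ → (Fin n → ℕ) → Fin n → Set
  ColorDominating k c v =
    ∀ j → 1 ≤ j → j ≤ k → j ≢ c v → ∃[ u ] (Adj v u × c u ≡ j)

  ZColoring : ℕ → (Fin n → ℕ) → Set
  ZColoring k c =
      GrundyColoring k c
    × (∀ i → 1 ≤ i → i ≤ k → ∃[ v ] (c v ≡ i × ColorDominating k c v))
    × (Σ (ℕ → Fin n) λ u →
          (∀ j → 1 ≤ j → j ≤ k → c (u j) ≡ j × ColorDominating k c (u j))
        × (∀ j → 1 ≤ j → j ≤ k → j ≢ k → Adj (u k) (u j)))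

  HasGrundyColoring : ℕ → Set
  HasGrundyColoring k = ∃[ c ] GrundyColoring k c

  HasZColoring : ℕ → Set
  HasZColoring k = ∃[ c ] ZColoring k c

IsMaximum : (ℕ → Set) → ℕ → Set
IsMaximum P m = P m × (∀ k → P k → k ≤ m)

IsGrundyNumber : ∀ {n} → Graph n → ℕ → Set
IsGrundyNumber G = IsMaximum (HasGrundyColoring G)

IsZNumber : ∀ {n} → Graph n → ℕ → Set
IsZNumber G = IsMaximum (HasZColoring G)

-- Root the tree at a vertex x of largest colour g of a Grundy coloring c and let k = ⌊g/2⌋ ≥ 1.
-- Recolour: x gets k + 1; a child y of x with c y ∈ [k, 2k) gets 2k − c y, so each colour 1..k
-- appears next to x; below such a y a vertex keeps its old colour as long as the old colours
-- decrease along the path from y, stay ≤ k and avoid the parent's new colour; every other vertex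
-- takes the first-fit colour against its parent (1, or 2 if the parent has 1).  On a descending
-- path the Grundy witnesses of smaller colour are children, hence keep their colour; this gives the
-- Grundy property and makes x and its recoloured children color-dominating, so z(T) ≥ k + 1 and
-- g ≤ 2k + 1 ≤ (k + 1)².  The rooting is grown one vertex at a time along walks from x; acyclicity
-- says a new vertex has only one neighbour in the part grown so far.

module Submission where

open import Defs
open import Data.Nat using (ℕ; zero; suc; _+_; _*_; _∸_; _≤_; _<_; z≤n; s≤s; _≤?_; _<?_; _≟_; ⌊_/2⌋)
open import Data.Nat.Properties
open import Data.Fin using (Fin; fromℕ<) renaming (_≟_ to _≟ᶠ_)
open import Data.Fin.Subset using (Subset; _∈_; _∉_; _⊆_; _∪_; ⁅_⁆)
open import Data.Fin.Subset.Properties using (_∈?_; x∈⁅x⁆; x∈⁅y⁆⇒x≡y; x∈p∪q⁺; x∈p∪q⁻)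
open import Data.List using (List; []; _∷_; _++_; allFin)
open import Data.List.Membership.Propositional.Properties using (∈-allFin)
open import Data.List.Relation.Unary.All as All using (All; []; _∷_)
open import Data.List.Relation.Unary.All.Properties as All using ()
open import Data.List.Relation.Unary.Any using (here)
open import Data.List.Relation.Unary.AllPairs using ([]; _∷_)
open import Data.List.Relation.Unary.Unique.Propositional using (Unique)
import Data.List.Relation.Unary.Unique.Propositional.Properties as Unique
open import Data.Vec.Functional using (updateAt)
open import Data.Vec.Functional.Properties using (updateAt-updates; updateAt-minimal)
open import Data.Product
open import Data.Sum using (_⊎_; inj₁; inj₂)
import Data.Sum as Sum
open import Data.Empty using (⊥-elim)
open import Data.Unit using (tt)
open import Function using (_∘_; id; const)
open import Relation.Nullary
open import Relation.Binary.PropositionalEquality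

IsChild : ∀ {n} → Fin n → (Fin n → Fin n) → Fin n → Fin n → Set
IsChild x parent v u = v ≢ x × parent v ≡ u

module _ {n : ℕ} {S : Subset n} {w : Fin n} where

  ∪⁅⁆⁺ˡ : ∀ {v} → v ∈ S → v ∈ S ∪ ⁅ w ⁆
  ∪⁅⁆⁺ˡ v∈S = x∈p∪q⁺ (inj₁ v∈S)

  ∪⁅⁆⁺ʳ : w ∈ S ∪ ⁅ w ⁆
  ∪⁅⁆⁺ʳ = x∈p∪q⁺ (inj₂ (x∈⁅x⁆ w))

  ∪⁅⁆⁻ : ∀ {v} → v ∈ S ∪ ⁅ w ⁆ → v ∈ S ⊎ v ≡ w
  ∪⁅⁆⁻ v∈ = Sum.map₂ (x∈⁅y⁆⇒x≡y w) (x∈p∪q⁻ S ⁅ w ⁆ v∈)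

module _ {n : ℕ} (G : Graph n) where
  open Graph G using () renaming (sym to adj-sym; irrefl to adj-irrefl)

  record PathIn (S : Subset n) (u v : Fin n) : Set where
    constructor path
    field
      rest   : List (Fin n)
      chain  : Chain G (u ∷ rest)
      unique : Unique (u ∷ rest)
      last   : Last G (u ∷ rest) v
      inside : All (_∈ S) (u ∷ rest)

  module _ {S : Subset n} where

    PathIn-refl : ∀ {u} → u ∈ S → PathIn S u u
    PathIn-refl u∈S = path [] tt ([] ∷ []) (last-one _) (u∈S ∷ [])

    PathIn-mono : ∀ {S′ u v} → S ⊆ S′ → PathIn S u v → PathIn S′ u v
    PathIn-mono S⊆S′ (path rest ch un la ins) = path rest ch un la (All.map S⊆S′ ins)

    ∉⇒fresh : ∀ {w xs} → w ∉ S → All (_∈ S) xs → All (w ≢_) xs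
    ∉⇒fresh w∉S = All.map λ z∈S w≡z → w∉S (subst (_∈ S) (sym w≡z) z∈S)

    chain-snoc : ∀ {u v w} rest → Chain G (u ∷ rest) → Last G (u ∷ rest) v → Adj G v w →
                 Chain G (u ∷ rest ++ w ∷ [])
    chain-snoc []       _         (last-one _)                 vw = vw , tt
    chain-snoc []       _         (last-cons _ _ _ ())         _
    chain-snoc (y ∷ ys) (uy , ch) (last-cons _ _ _ y∷ys-last) vw = uy , chain-snoc ys ch y∷ys-last vw

    last-snoc : ∀ {w} u rest → Last G (u ∷ rest ++ w ∷ []) w
    last-snoc u []       = last-cons u _ _ (last-one _)
    last-snoc u (y ∷ ys) = last-cons u _ _ (last-snoc y ys)

    PathIn-cons : ∀ {u v w} → Adj G w u → w ∉ S → PathIn S u v → PathIn (S ∪ ⁅ w ⁆) w v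
    PathIn-cons wu w∉S (path rest ch un la ins) =
      path (_ ∷ rest) (wu , ch) (∉⇒fresh w∉S ins ∷ un) (last-cons _ _ _ la)
           (∪⁅⁆⁺ʳ ∷ All.map ∪⁅⁆⁺ˡ ins)

    PathIn-snoc : ∀ {u v w} → PathIn S u v → Adj G v w → w ∉ S → PathIn (S ∪ ⁅ w ⁆) u w
    PathIn-snoc {u} (path rest ch un la ins) vw w∉S =
      path (rest ++ _ ∷ []) (chain-snoc rest ch la vw)
           (Unique.++⁺ un ([] ∷ []) λ { (z∈ , here refl) → w∉S (All.lookup ins z∈) })
           (last-snoc u rest) (All.++⁺ (All.map ∪⁅⁆⁺ˡ ins) (∪⁅⁆⁺ʳ ∷ []))

  record PartialRooting (x : Fin n) (S : Subset n) : Set where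
    field
      parent           : Fin n → Fin n
      depth            : Fin n → ℕ
      root∈            : x ∈ S
      depth-root       : depth x ≡ 0
      parent∈          : ∀ {v} → v ∈ S → v ≢ x → parent v ∈ S
      parent-adj       : ∀ {v} → v ∈ S → v ≢ x → Adj G v (parent v)
      depth-parent     : ∀ {v} → v ∈ S → v ≢ x → depth v ≡ suc (depth (parent v))
      adj⇒child⊎parent : ∀ {u v} → u ∈ S → v ∈ S → Adj G u v →
                         IsChild x parent v u ⊎ IsChild x parent u v
      paths            : ∀ {u v} → u ∈ S → v ∈ S → PathIn S u v

  record Rooting (x : Fin n) : Set where
    field
      parent           : Fin n → Fin n
      depth            : Fin n → ℕ
      depth-root       : depth x ≡ 0
      parent-adj       : ∀ v → v ≢ x → Adj G v (parent v)
      depth-parent     : ∀ v → v ≢ x → depth v ≡ suc (depth (parent v))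
      adj⇒child⊎parent : ∀ u v → Adj G u v → IsChild x parent v u ⊎ IsChild x parent u v

    root-neighbour⇒child : ∀ {w} → Adj G x w → IsChild x parent w x
    root-neighbour⇒child {w} xw with adj⇒child⊎parent x w xw
    ... | inj₁ w-child  = w-child
    ... | inj₂ (x≢x , _) = ⊥-elim (x≢x refl)

  PartialRooting-⁅⁆ : ∀ x → PartialRooting x ⁅ x ⁆
  PartialRooting-⁅⁆ x = record
    { parent = id ; depth = const 0 ; root∈ = x∈⁅x⁆ x ; depth-root = refl
    ; parent∈ = absurd ; parent-adj = absurd ; depth-parent = absurd
    ; adj⇒child⊎parent = λ u∈ v∈ uv →
        ⊥-elim (adj-irrefl x (subst₂ (Adj G) (x∈⁅y⁆⇒x≡y x u∈) (x∈⁅y⁆⇒x≡y x v∈) uv))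
    ; paths = λ u∈ v∈ →
        subst₂ (PathIn ⁅ x ⁆) (sym (x∈⁅y⁆⇒x≡y x u∈)) (sym (x∈⁅y⁆⇒x≡y x v∈)) (PathIn-refl (x∈⁅x⁆ x)) }
    where
    absurd : ∀ {A : Set} {v} → v ∈ ⁅ x ⁆ → v ≢ x → A
    absurd v∈ v≢x = ⊥-elim (v≢x (x∈⁅y⁆⇒x≡y x v∈))

  module _ (acyclic : ¬ HasCycle G) where

    attachment-unique : ∀ {S a b w} → PathIn S a b → w ∉ S → Adj G w a → Adj G w b → a ≡ b
    attachment-unique (path [] _ _ (last-one _) _)          _   _  _  = refl
    attachment-unique (path [] _ _ (last-cons _ _ _ ()) _)  _   _  _
    attachment-unique {w = w} (path (y ∷ ys) ch un la ins) w∉S wa wb =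
      ⊥-elim (acyclic (w , _ ∷ y ∷ ys , _ , s≤s (s≤s z≤n) , ∉⇒fresh w∉S ins ∷ un ,
                       (wa , ch) , la , adj-sym w _ wb))

    extend : ∀ {x S a w} → PartialRooting x S → a ∈ S → w ∉ S → Adj G a w →
             PartialRooting x (S ∪ ⁅ w ⁆)
    extend {x} {S} {a} {w} R a∈S w∉S aw = record
      { parent = parent′ ; depth = depth′ ; root∈ = ∪⁅⁆⁺ˡ root∈
      ; depth-root = trans (depth-old root∈) depth-root
      ; parent∈ = parent∈′ ; parent-adj = parent-adj′ ; depth-parent = depth-parent′
      ; adj⇒child⊎parent = adj⇒child⊎parent′ ; paths = paths′ }
      where
      open PartialRooting R

      parent′ : Fin n → Fin n
      parent′ = updateAt parent w (const a)

      depth′ : Fin n → ℕ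
      depth′ = updateAt depth w (const (suc (depth a)))

      old≢w : ∀ {v} → v ∈ S → v ≢ w
      old≢w v∈S refl = w∉S v∈S

      w≢x : w ≢ x
      w≢x refl = w∉S root∈

      parent-old : ∀ {v} → v ∈ S → parent′ v ≡ parent v
      parent-old v∈S = updateAt-minimal _ w parent (old≢w v∈S)

      depth-old : ∀ {v} → v ∈ S → depth′ v ≡ depth v
      depth-old v∈S = updateAt-minimal _ w depth (old≢w v∈S)

      child-old : ∀ {u v} → v ∈ S → IsChild x parent v u → IsChild x parent′ v u
      child-old v∈S (v≢x , pv≡u) = v≢x , trans (parent-old v∈S) pv≡u

      neighbour-of-w : ∀ {v} → v ∈ S → Adj G w v → v ≡ a
      neighbour-of-w v∈S wv = sym (attachment-unique (paths a∈S v∈S) w∉S (adj-sym a w aw) wv)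

      parent∈′ : ∀ {v} → v ∈ S ∪ ⁅ w ⁆ → v ≢ x → parent′ v ∈ S ∪ ⁅ w ⁆
      parent∈′ v∈ v≢x with ∪⁅⁆⁻ v∈
      ... | inj₁ v∈S rewrite parent-old v∈S = ∪⁅⁆⁺ˡ (parent∈ v∈S v≢x)
      ... | inj₂ refl rewrite updateAt-updates w {const a} parent = ∪⁅⁆⁺ˡ a∈S

      parent-adj′ : ∀ {v} → v ∈ S ∪ ⁅ w ⁆ → v ≢ x → Adj G v (parent′ v)
      parent-adj′ v∈ v≢x with ∪⁅⁆⁻ v∈
      ... | inj₁ v∈S rewrite parent-old v∈S = parent-adj v∈S v≢x
      ... | inj₂ refl rewrite updateAt-updates w {const a} parent = adj-sym a w aw

      depth-parent′ : ∀ {v} → v ∈ S ∪ ⁅ w ⁆ → v ≢ x → depth′ v ≡ suc (depth′ (parent′ v))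
      depth-parent′ v∈ v≢x with ∪⁅⁆⁻ v∈
      ... | inj₁ v∈S rewrite parent-old v∈S | depth-old v∈S | depth-old (parent∈ v∈S v≢x) =
        depth-parent v∈S v≢x
      ... | inj₂ refl rewrite updateAt-updates w {const a} parent
                            | updateAt-updates w {const (suc (depth a))} depth
                            | depth-old a∈S = refl

      adj⇒child⊎parent′ : ∀ {u v} → u ∈ S ∪ ⁅ w ⁆ → v ∈ S ∪ ⁅ w ⁆ → Adj G u v →
                          IsChild x parent′ v u ⊎ IsChild x parent′ u v
      adj⇒child⊎parent′ u∈ v∈ uv with ∪⁅⁆⁻ u∈ | ∪⁅⁆⁻ v∈
      ... | inj₁ u∈S | inj₁ v∈S = Sum.map (child-old v∈S) (child-old u∈S) (adj⇒child⊎parent u∈S v∈S uv)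
      ... | inj₂ refl | inj₂ refl = ⊥-elim (adj-irrefl w uv)
      ... | inj₂ refl | inj₁ v∈S rewrite neighbour-of-w v∈S uv =
        inj₂ (w≢x , updateAt-updates w parent)
      ... | inj₁ u∈S | inj₂ refl rewrite neighbour-of-w u∈S (adj-sym _ w uv) =
        inj₁ (w≢x , updateAt-updates w parent)

      paths′ : ∀ {u v} → u ∈ S ∪ ⁅ w ⁆ → v ∈ S ∪ ⁅ w ⁆ → PathIn (S ∪ ⁅ w ⁆) u v
      paths′ u∈ v∈ with ∪⁅⁆⁻ u∈ | ∪⁅⁆⁻ v∈
      ... | inj₁ u∈S | inj₁ v∈S = PathIn-mono ∪⁅⁆⁺ˡ (paths u∈S v∈S)
      ... | inj₂ refl | inj₂ refl = PathIn-refl ∪⁅⁆⁺ʳ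
      ... | inj₂ refl | inj₁ v∈S = PathIn-cons (adj-sym a w aw) w∉S (paths a∈S v∈S)
      ... | inj₁ u∈S | inj₂ refl = PathIn-snoc (paths u∈S a∈S) aw w∉S

    grow-along : ∀ {x S a v} → PartialRooting x S → a ∈ S → Walk G a v →
                 ∃[ S′ ] (PartialRooting x S′ × S ⊆ S′ × v ∈ S′)
    grow-along R a∈S (here _) = _ , R , id , a∈S
    grow-along {S = S} R a∈S (step _ w _ aw walk) with w ∈? S
    ... | yes w∈S = grow-along R w∈S walk
    ... | no w∉S with grow-along (extend R a∈S w∉S aw) ∪⁅⁆⁺ʳ walk
    ...   | S′ , R′ , ⊆S′ , v∈S′ = S′ , R′ , ⊆S′ ∘ ∪⁅⁆⁺ˡ , v∈S′

    grow-over : Connected G → ∀ x (vs : List (Fin n)) →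
                ∃[ S ] (PartialRooting x S × All (_∈ S) vs)
    grow-over conn x [] = ⁅ x ⁆ , PartialRooting-⁅⁆ x , []
    grow-over conn x (v ∷ vs) with grow-over conn x vs
    ... | S , R , vs∈S with grow-along R (PartialRooting.root∈ R) (conn x v)
    ...   | S′ , R′ , S⊆S′ , v∈S′ = S′ , R′ , v∈S′ ∷ All.map S⊆S′ vs∈S

    rooting : Connected G → ∀ x → Rooting x
    rooting conn x with grow-over conn x (allFin n)
    ... | S , R , all∈S = record
      { parent = parent ; depth = depth ; depth-root = depth-root
      ; parent-adj = λ v → parent-adj (every v)
      ; depth-parent = λ v → depth-parent (every v)
      ; adj⇒child⊎parent = λ u v → adj⇒child⊎parent (every u) (every v) }
      where
      open PartialRooting R
      every : ∀ v → v ∈ S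
      every v = All.lookup all∈S (∈-allFin v)

firstFit : ℕ → ℕ
firstFit 1 = 2
firstFit _ = 1

firstFit-≢ : ∀ t → firstFit t ≢ t
firstFit-≢ zero          ()
firstFit-≢ (suc zero)    ()
firstFit-≢ (suc (suc t)) ()

firstFit-range : ∀ t → 1 ≤ firstFit t × firstFit t ≤ 2
firstFit-range zero          = s≤s z≤n , s≤s z≤n
firstFit-range (suc zero)    = s≤s z≤n , ≤-refl
firstFit-range (suc (suc t)) = s≤s z≤n , s≤s z≤n

firstFit-grundy : ∀ t {i} → 1 ≤ i → i < firstFit t → t ≡ i
firstFit-grundy (suc zero)    {suc zero}    _ _                   = refl
firstFit-grundy (suc zero)    {suc (suc i)} _ (s≤s (s≤s ()))
firstFit-grundy zero          {suc i}       _ (s≤s ())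
firstFit-grundy (suc (suc t)) {suc i}       _ (s≤s ())

reflect : ℕ → ℕ → ℕ
reflect k a = k + k ∸ a

InBand : ℕ → ℕ → Set
InBand k a = k ≤ a × a < k + k

module _ {k : ℕ} where

  reflect-≤ : ∀ {a} → k ≤ a → reflect k a ≤ k
  reflect-≤ k≤a = ≤-trans (∸-monoʳ-≤ (k + k) k≤a) (≤-reflexive (m+n∸m≡n k k))

  reflect-≥ : ∀ {i} → i ≤ k → k ≤ reflect k i
  reflect-≥ i≤k = ≤-trans (≤-reflexive (sym (m+n∸m≡n k k))) (∸-monoʳ-≤ (k + k) i≤k)

  reflect-inBand : ∀ {i} → 1 ≤ i → i ≤ k → InBand k (reflect k i)
  reflect-inBand 1≤i i≤k = reflect-≥ i≤k , ∸-monoʳ-< 1≤i (≤-trans i≤k (m≤m+n k k))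

  reflect-involutive : ∀ {a} → a ≤ k + k → reflect k (reflect k a) ≡ a
  reflect-involutive = m∸[m∸n]≡n

  reflect-separates : ∀ {i j} → i ≤ k → j ≤ k → i ≢ j → i < reflect k j
  reflect-separates {i} {j} i≤k j≤k i≢j with m≤n⇒m<n∨m≡n i≤k
  ... | inj₁ i<k  = <-≤-trans i<k (reflect-≥ j≤k)
  ... | inj₂ refl = subst (k <_) (sym (+-∸-assoc k j≤k))
                          (m<m+n k (m<n⇒0<n∸m (≤∧≢⇒< j≤k (i≢j ∘ sym))))

data Kind : Set where
  root top descending other : Kind

data Continues : Kind → Set where
  top        : Continues top
  descending : Continues descending

¬Continues-root : ¬ Continues root
¬Continues-root ()

module Recoloring {n : ℕ} {G : Graph n} {x : Fin n} (R : Rooting G x)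
                  {c : Fin n → ℕ} (c-pos : ∀ v → 1 ≤ c v) (c-grundy : GrundyCondition G c)
                  {k : ℕ} (1≤k : 1 ≤ k) (2k≤cx : k + k ≤ c x) where
  open Rooting R
  open Graph G using () renaming (sym to adj-sym)

  Label : Set
  Label = Kind × ℕ

  Keeps : ℕ → ℕ → ℕ → Set
  Keeps t cp a = a < cp × a ≤ k × a ≢ t

  keeps? : ∀ t cp a → Dec (Keeps t cp a)
  keeps? t cp a = (a <? cp) ×-dec (a ≤? k) ×-dec ¬? (a ≟ t)

  descend : ℕ → ℕ → ℕ → Label
  descend t cp a with keeps? t cp a
  ... | yes _ = descending , a
  ... | no  _ = other , firstFit t

  inBand? : ∀ a → Dec (InBand k a)
  inBand? a = (k ≤? a) ×-dec (a <? k + k)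

  -- relabel ℓ cp a is the new label of a vertex of old colour a whose parent has label ℓ and
  -- old colour cp; the ℕ in a label is the new colour.
  relabel : Label → ℕ → ℕ → Label
  relabel (root , t) cp a with inBand? a
  ... | yes _ = top , reflect k a
  ... | no  _ = other , firstFit t
  relabel (top , t)        cp a = descend t cp a
  relabel (descending , t) cp a = descend t cp a
  relabel (other , t)      cp a = other , firstFit t

  data RelabelView (s : Kind) (t cp a : ℕ) : Label → Set where
    enter : s ≡ root → InBand k a → RelabelView s t cp a (top , reflect k a)
    keep  : Continues s → Keeps t cp a → RelabelView s t cp a (descending , a)
    leave : (s ≡ root → ¬ InBand k a) → RelabelView s t cp a (other , firstFit t)

  descendView : ∀ {s} → Continues s → ∀ t cp a → RelabelView s t cp a (descend t cp a)
  descendView cont t cp a with keeps? t cp a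
  ... | yes ks = keep cont ks
  ... | no  _  = leave λ { refl → ⊥-elim (¬Continues-root cont) }

  relabelView : ∀ s t cp a → RelabelView s t cp a (relabel (s , t) cp a)
  relabelView root t cp a with inBand? a
  ... | yes band = enter refl band
  ... | no ¬band = leave λ _ → ¬band
  relabelView top        = descendView top
  relabelView descending = descendView descending
  relabelView other t cp a = leave λ ()

  descend-keep : ∀ {t cp a} → Keeps t cp a → descend t cp a ≡ (descending , a)
  descend-keep {t} {cp} {a} ks with keeps? t cp a
  ... | yes _  = refl
  ... | no ¬ks = contradiction ks ¬ks

  relabel-keep : ∀ {s t cp a} → Continues s → Keeps t cp a → relabel (s , t) cp a ≡ (descending , a)
  relabel-keep top        = descend-keep
  relabel-keep descending = descend-keep

  relabel-kind≢root : ∀ l cp a → proj₁ (relabel l cp a) ≢ root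
  relabel-kind≢root (s , t) cp a with relabel (s , t) cp a | relabelView s t cp a
  ... | _ | enter _ _ = λ ()
  ... | _ | keep _ _  = λ ()
  ... | _ | leave _   = λ ()

  labelAt : ℕ → Fin n → Label
  labelAt zero    _ = root , suc k
  labelAt (suc d) v = relabel (labelAt d (parent v)) (c (parent v)) (c v)

  label : Fin n → Label
  label v = labelAt (depth v) v

  kind : Fin n → Kind
  kind v = proj₁ (label v)

  c′ : Fin n → ℕ
  c′ v = proj₂ (label v)

  label-root : label x ≡ (root , suc k)
  label-root rewrite depth-root = refl

  c′-root : c′ x ≡ suc k
  c′-root = cong proj₂ label-root

  label-child : ∀ v → v ≢ x → label v ≡ relabel (label (parent v)) (c (parent v)) (c v)
  label-child v v≢x rewrite depth-parent v v≢x = refl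

  kind≡root⇒root : ∀ v → kind v ≡ root → v ≡ x
  kind≡root⇒root v kv with v ≟ᶠ x
  ... | yes v≡x = v≡x
  ... | no  v≢x = ⊥-elim (relabel-kind≢root (label (parent v)) _ _
                            (trans (sym (cong proj₁ (label-child v v≢x))) kv))

  c′≡ : ∀ {v s t} → label v ≡ (s , t) → c′ v ≡ t
  c′≡ = cong proj₂

  continues : ∀ {v s t} → label v ≡ (s , t) → Continues s → Continues (kind v)
  continues eq = subst Continues (sym (cong proj₁ eq))

  data Class (v : Fin n) : Set where
    top-vertex        : parent v ≡ x → InBand k (c v) → label v ≡ (top , reflect k (c v)) → Class v
    descending-vertex : Continues (kind (parent v)) → Keeps (c′ (parent v)) (c (parent v)) (c v) →
                        label v ≡ (descending , c v) → Class v
    other-vertex      : (parent v ≡ x → ¬ InBand k (c v)) →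
                        label v ≡ (other , firstFit (c′ (parent v))) → Class v

  classify : ∀ v → v ≢ x → Class v
  classify v v≢x = fromView (relabelView (kind (parent v)) (c′ (parent v)) (c (parent v)) (c v))
                            (label-child v v≢x)
    where
    fromView : ∀ {l} → RelabelView (kind (parent v)) (c′ (parent v)) (c (parent v)) (c v) l →
               label v ≡ l → Class v
    fromView (enter r band) = top-vertex (kind≡root⇒root (parent v) r) band
    fromView (keep cont ks) = descending-vertex cont ks
    fromView (leave ¬band)  = other-vertex λ pv≡x → ¬band (trans (cong kind pv≡x) (cong proj₁ label-root))

  smaller-neighbour⇒child : ∀ {v w} → c v < c (parent v) → Adj G v w → c w < c v → IsChild x parent w v
  smaller-neighbour⇒child {v} {w} below vw cw<cv with adj⇒child⊎parent v w vw
  ... | inj₁ w-child    = w-child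
  ... | inj₂ (_ , pv≡w) = ⊥-elim (<-asym cw<cv (subst (λ u → c v < c u) pv≡w below))

  descending-neighbour : ∀ {v} → Continues (kind v) → c v < c (parent v) →
                         ∀ i → 1 ≤ i → i < c v → i ≤ k → i ≢ c′ v → ∃[ w ] (Adj G v w × c′ w ≡ i)
  descending-neighbour {v} cont below i 1≤i i<cv i≤k i≢c′v with c-grundy v i 1≤i i<cv
  ... | w , vw , refl with smaller-neighbour⇒child below vw i<cv
  ...   | w≢x , refl = w , vw , c′≡ (trans (label-child w w≢x) (relabel-keep cont (i<cv , i≤k , i≢c′v)))

  top-below : ∀ {v} → parent v ≡ x → c v < k + k → c v < c (parent v)
  top-below {v} pv≡x cv<2k = subst (λ u → c v < c u) (sym pv≡x) (<-≤-trans cv<2k 2k≤cx)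

  root-grundy : ∀ j → 1 ≤ j → j ≤ k → ∃[ y ] (Adj G x y × c y ≡ reflect k j)
  root-grundy j 1≤j j≤k =
    let k≤r , r<2k = reflect-inBand 1≤j j≤k
    in  c-grundy x (reflect k j) (≤-trans 1≤k k≤r) (<-≤-trans r<2k 2k≤cx)

  record TopChild (j : ℕ) (y : Fin n) : Set where
    field
      root-adj : Adj G x y
      parent≡x : parent y ≡ x
      colour   : c y ≡ reflect k j
      label≡   : label y ≡ (top , j)

  top-child : ∀ j → 1 ≤ j → j ≤ k → ∃ (TopChild j)
  top-child j 1≤j j≤k with root-grundy j 1≤j j≤k
  ... | y , xy , cy≡ with root-neighbour⇒child xy
  ...   | y≢x , py≡x with classify y y≢x
  ...     | top-vertex _ _ eq = y , record
              { root-adj = xy ; parent≡x = py≡x ; colour = cy≡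
              ; label≡ = trans eq (cong (top ,_) (trans (cong (reflect k) cy≡)
                                                        (reflect-involutive {k = k} (≤-trans j≤k (m≤m+n k k))))) }
  ...     | descending-vertex cont _ _ =
              ⊥-elim (¬Continues-root (subst Continues (trans (cong kind py≡x) (cong proj₁ label-root)) cont))
  ...     | other-vertex ¬band _ =
              ⊥-elim (¬band py≡x (subst (InBand k) (sym cy≡) (reflect-inBand 1≤j j≤k)))

  root-sees : ∀ j → 1 ≤ j → j ≤ k → ∃[ y ] (Adj G x y × c′ y ≡ j)
  root-sees j 1≤j j≤k with top-child j 1≤j j≤k
  ... | y , t = y , TopChild.root-adj t , c′≡ (TopChild.label≡ t)

  InRange : ℕ → Set
  InRange t = 1 ≤ t × t ≤ suc k

  c′-range : ∀ v → InRange (c′ v)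
  c′-range v with v ≟ᶠ x
  ... | yes refl = subst InRange (sym c′-root) (s≤s z≤n , ≤-refl)
  ... | no v≢x with classify v v≢x
  ... | top-vertex _ (k≤cv , cv<2k) eq =
        subst InRange (sym (c′≡ eq)) (m<n⇒0<n∸m cv<2k , m≤n⇒m≤1+n (reflect-≤ k≤cv))
  ... | descending-vertex _ (_ , cv≤k , _) eq =
        subst InRange (sym (c′≡ eq)) (c-pos v , m≤n⇒m≤1+n cv≤k)
  ... | other-vertex _ eq =
        subst InRange (sym (c′≡ eq)) (map₂ (λ ≤2 → ≤-trans ≤2 (s≤s 1≤k)) (firstFit-range _))

  child-colour≢ : ∀ v → v ≢ x → c′ v ≢ c′ (parent v)
  child-colour≢ v v≢x with classify v v≢x
  ... | top-vertex pv≡x (k≤cv , _) eq =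
        <⇒≢ (subst₂ _<_ (sym (c′≡ eq)) (sym (trans (cong c′ pv≡x) c′-root)) (s≤s (reflect-≤ k≤cv)))
  ... | descending-vertex _ (_ , _ , cv≢) eq = cv≢ ∘ trans (sym (c′≡ eq))
  ... | other-vertex _ eq = firstFit-≢ _ ∘ trans (sym (c′≡ eq))

  c′-proper : ∀ u v → Adj G u v → c′ u ≢ c′ v
  c′-proper u v uv with adj⇒child⊎parent u v uv
  ... | inj₁ (v≢x , refl) = child-colour≢ v v≢x ∘ sym
  ... | inj₂ (u≢x , refl) = child-colour≢ u u≢x

  c′-grundy : GrundyCondition G c′
  c′-grundy v i 1≤i i<c′v with v ≟ᶠ x
  ... | yes refl = root-sees i 1≤i (≤-pred (subst (i <_) c′-root i<c′v))
  ... | no v≢x with classify v v≢x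
  ... | top-vertex pv≡x (k≤cv , cv<2k) eq =
        descending-neighbour (continues eq top) (top-below pv≡x cv<2k) i 1≤i
          (<-≤-trans i<r (≤-trans (reflect-≤ k≤cv) k≤cv)) (≤-trans (<⇒≤ i<r) (reflect-≤ k≤cv)) (<⇒≢ i<c′v)
    where i<r = subst (i <_) (c′≡ eq) i<c′v
  ... | descending-vertex _ (cv<cp , cv≤k , _) eq =
        descending-neighbour (continues eq descending) cv<cp i 1≤i i<cv (≤-trans (<⇒≤ i<cv) cv≤k) (<⇒≢ i<c′v)
    where i<cv = subst (i <_) (c′≡ eq) i<c′v
  ... | other-vertex _ eq =
        parent v , parent-adj v v≢x , firstFit-grundy _ 1≤i (subst (i <_) (c′≡ eq) i<c′v)

  Dominating : Fin n → Set
  Dominating = ColorDominating G (suc k) c′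

  root-dominating : Dominating x
  root-dominating j 1≤j j≤K j≢c′x = root-sees j 1≤j (≤-pred (≤∧≢⇒< j≤K λ j≡K → j≢c′x (trans j≡K (sym c′-root))))

  top-child-dominating : ∀ {j y} → TopChild j y → 1 ≤ j → j ≤ k → Dominating y
  top-child-dominating {j} {y} t 1≤j j≤k i 1≤i i≤K i≢c′y with i ≟ suc k
  ... | yes refl = x , adj-sym x y (TopChild.root-adj t) , c′-root
  ... | no i≢K =
        descending-neighbour (continues label≡ top) (top-below parent≡x (subst (_< k + k) (sym colour) (proj₂ band)))
          i 1≤i (subst (i <_) (sym colour) (reflect-separates i≤k j≤k i≢j)) i≤k i≢c′y
    where
    open TopChild t
    band = reflect-inBand 1≤j j≤k
    i≤k = ≤-pred (≤∧≢⇒< i≤K i≢K)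
    i≢j = λ i≡j → i≢c′y (trans i≡j (sym (c′≡ label≡)))

  dominator : ℕ → Fin n
  dominator j with (1 ≤? j) ×-dec (j ≤? k)
  ... | yes (1≤j , j≤k) = proj₁ (top-child j 1≤j j≤k)
  ... | no  _           = x

  dominator-top : ∀ {j} → 1 ≤ j → j ≤ k → TopChild j (dominator j)
  dominator-top {j} 1≤j j≤k with (1 ≤? j) ×-dec (j ≤? k)
  ... | yes (1≤j′ , j≤k′) = proj₂ (top-child j 1≤j′ j≤k′)
  ... | no  ¬range        = contradiction (1≤j , j≤k) ¬range

  dominator-root : dominator (suc k) ≡ x
  dominator-root with (1 ≤? suc k) ×-dec (suc k ≤? k)
  ... | yes (_ , k+1≤k) = contradiction k+1≤k 1+n≰n
  ... | no  _           = refl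

  dominator-spec : ∀ j → 1 ≤ j → j ≤ suc k → c′ (dominator j) ≡ j × Dominating (dominator j)
  dominator-spec j 1≤j j≤K with j ≟ suc k
  ... | yes refl rewrite dominator-root = c′-root , root-dominating
  ... | no  j≢K = c′≡ (TopChild.label≡ t) , top-child-dominating t 1≤j j≤k
    where
    j≤k = ≤-pred (≤∧≢⇒< j≤K j≢K)
    t = dominator-top 1≤j j≤k

  dominator-root-adj : ∀ j → 1 ≤ j → j ≤ suc k → j ≢ suc k → Adj G (dominator (suc k)) (dominator j)
  dominator-root-adj j 1≤j j≤K j≢K rewrite dominator-root =
    TopChild.root-adj (dominator-top 1≤j (≤-pred (≤∧≢⇒< j≤K j≢K)))

  z-coloring : ZColoring G (suc k) c′
  z-coloring = ((c′-range , c′-proper , λ i 1≤i i≤K → dominator i , proj₁ (dominator-spec i 1≤i i≤K)) , c′-grundy)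
             , (λ i 1≤i i≤K → dominator i , dominator-spec i 1≤i i≤K)
             , dominator , dominator-spec , dominator-root-adj

grundyColor⇒HasZColoring : ∀ {n} {G : Graph n} → Connected G → ¬ HasCycle G →
                           ∀ {c} → (∀ v → 1 ≤ c v) → GrundyCondition G c →
                           ∀ {x k} → 1 ≤ k → k + k ≤ c x → HasZColoring G (suc k)
grundyColor⇒HasZColoring {G = G} conn acyclic c-pos c-grundy {x} 1≤k 2k≤cx = c′ , z-coloring
  where open Recoloring (rooting G acyclic conn x) c-pos c-grundy 1≤k 2k≤cx

half-bounds : ∀ g → ⌊ g /2⌋ + ⌊ g /2⌋ ≤ g × g ≤ suc (⌊ g /2⌋ + ⌊ g /2⌋)
half-bounds zero             = z≤n , z≤n
half-bounds (suc zero)       = z≤n , ≤-refl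
half-bounds (suc (suc g)) rewrite +-suc ⌊ g /2⌋ ⌊ g /2⌋ = map (s≤s ∘ s≤s) (s≤s ∘ s≤s) (half-bounds g)

odd≤square : ∀ k → suc (k + k) ≤ suc k * suc k
odd≤square k = s≤s (+-monoʳ-≤ k (m≤m*n k (suc k)))

theorem4 : ∀ {n : ℕ} (T : Graph n) → IsTree T →
           ∀ (g m : ℕ) → IsGrundyNumber T g → IsZNumber T m → g ≤ m * m
theorem4 T (1≤n , conn , acyclic) g m ((c , (c-range , _ , c-onto) , c-grundy) , _)
         ((z , ((z-range , _) , _) , _) , z-max)
  with ⌊ g /2⌋ | half-bounds g
... | zero | _ , g≤1 = ≤-trans g≤1 (*-mono-≤ 1≤m 1≤m)
  where
  1≤m : 1 ≤ m
  1≤m = uncurry ≤-trans (z-range (fromℕ< 1≤n))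
... | k@(suc _) | 2k≤g , g≤2k+1 = ≤-trans g≤2k+1 (≤-trans (odd≤square k) (*-mono-≤ k+1≤m k+1≤m))
  where
  top-colored : ∃[ x ] c x ≡ g
  top-colored = c-onto g (≤-trans (s≤s z≤n) 2k≤g) ≤-refl
  k+1≤m : suc k ≤ m
  k+1≤m = z-max (suc k) (grundyColor⇒HasZColoring conn acyclic (proj₁ ∘ c-range) c-grundy (s≤s z≤n)
                          (subst (k + k ≤_) (sym (proj₂ top-colored)) 2k≤g))
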